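{- Let $\mathcal{R}$ be a symmetric $4$-class association scheme whose fusing-relations graph contains $K_{1,3}$ as a subgraph. Then $\mathcal{R}$ is amorphic.
   Context: A symmetric $d$-class association scheme on a finite set $X$ is a set $\mathcal{R}=\{A_0,\dots,A_d\}$ of $X\times X$ $01$-matrices with $A_0=I$, $\sum_iA_i=J$, $A_i^\top=A_i$, $A_iA_j=\sum_h p_{ij}^hA_h$. A pair $\{A_i,A_j\}$ ($i\ne j$, $i,j\ge1$) fuses if replacing $A_i,A_j$ by $A_i+A_j$ (keeping the others) yields an association scheme. The fusing-relations graph of $\mathcal{R}$ has vertex set $\{1,\dots,d\}$, with $i\sim j$ iff $\{A_i,A_j\}$ fuses. $\mathcal{R}$ is amorphic if for every partition of $\{0,\dots,d\}$ having $\{0\}$ as a part, the sums of the $A_l$ over the parts form an association scheme. -}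

module Defs where

open import Data.Nat using (ℕ; zero; suc; _+_; _*_)
open import Data.Fin using (Fin; zero; suc)
open import Data.Product using (Σ; ∃; ∃-syntax; _×_; _,_)
open import Data.Sum using (_⊎_)
open import Relation.Nullary using (¬_; yes; no)
open import Relation.Binary.PropositionalEquality using (_≡_; _≢_)
open import Function.Bundles using (_⇔_)
import Data.Fin as F

Σ[<_] : (m : ℕ) → (Fin m → ℕ) → ℕ
Σ[< zero ] f = 0
Σ[< suc m ] f = f zero + Σ[< m ] (λ i → f (suc i))

Mat : ℕ → Set
Mat n = Fin n → Fin n → ℕ

Id : (n : ℕ) → Mat n
Id n x y with x F.≟ y
... | yes _ = 1
... | no _ = 0

_⊗_ : {n : ℕ} → Mat n → Mat n → Mat n
_⊗_ {n} A B x y = Σ[< n ] (λ z → A x z * B z y)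

-- A symmetric d-class association scheme on X = Fin n, given by the
-- family of 01-matrices A₀,…,A_d (indexed by Fin (suc d)).
record IsSymAssocScheme (n d : ℕ) (A : Fin (suc d) → Mat n) : Set where
  field
    zero-one  : ∀ i x y → A i x y ≡ 0 ⊎ A i x y ≡ 1
    nonzero   : ∀ i → ∃[ x ] ∃[ y ] A i x y ≡ 1
    A₀≡I      : ∀ x y → A zero x y ≡ Id n x y
    sum≡J     : ∀ x y → Σ[< suc d ] (λ i → A i x y) ≡ 1
    symmetric : ∀ i x y → A i x y ≡ A i y x
    closed    : ∀ i j → Σ (Fin (suc d) → ℕ) λ p → ∀ x y →
                  (A i ⊗ A j) x y ≡ Σ[< suc d ] (λ h → p h * A h x y)

-- Fusion along a map f : {0..d} → {0..e}: the parts are the fibres of f,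
-- and the new k-th matrix is the sum of the A_l with f l = k.
fuse : {n d e : ℕ} → (Fin (suc d) → Fin (suc e)) → (Fin (suc d) → Mat n)
     → Fin (suc e) → Mat n
fuse {d = d} f A k x y = Σ[< suc d ] (λ l → sel (f l F.≟ k) (A l x y))
  where
  sel : {P : Set} → Relation.Nullary.Dec P → ℕ → ℕ
  sel (yes _) m = m
  sel (no _) _ = 0

-- f describes a partition of {0,…,d} (into the e+1 nonempty fibres)
-- having {0} as a part (with label 0).
IsPartitionMap : {d e : ℕ} → (Fin (suc d) → Fin (suc e)) → Set
IsPartitionMap f = (∀ k → ∃[ l ] f l ≡ k) × (∀ l → (f l ≡ zero) ⇔ (l ≡ zero))

Amorphic : (n d : ℕ) → (Fin (suc d) → Mat n) → Set
Amorphic n d A = ∀ e (f : Fin (suc d) → Fin (suc e)) → IsPartitionMap f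
               → IsSymAssocScheme n e (fuse f A)

-- The pair {A_i, A_j} (i ≠ j, i, j ≥ 1) fuses: merging exactly i and j
-- (all other relations kept) yields an association scheme.
-- (d classes become d - 1 classes; d = suc d' below.)
PairFuses : (n d' : ℕ) → (Fin (suc (suc d')) → Mat n) → Fin (suc (suc d')) → Fin (suc (suc d')) → Set
PairFuses n d' A i j =
  i ≢ zero × j ≢ zero × i ≢ j ×
  Σ (Fin (suc (suc d')) → Fin (suc d')) λ f → ((∀ l l' → (f l ≡ f l') ⇔ (l ≡ l' ⊎ (l ≡ i × l' ≡ j) ⊎ (l ≡ j × l' ≡ i)))
         × (f zero ≡ zero)
         × IsSymAssocScheme n d' (fuse {d = suc d'} {e = d'} f A))

-- The fusing-relations graph (on vertices 1..d) contains K_{1,3}: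
-- a centre c and three distinct further vertices a, b, e, all adjacent to c.
ContainsK13 : (n d' : ℕ) → (Fin (suc (suc d')) → Mat n) → Set
ContainsK13 n d' A = ∃[ c ] ∃[ a ] ∃[ b ] ∃[ e ]
  (a ≢ b × a ≢ e × b ≢ e ×
   PairFuses n d' A c a × PairFuses n d' A c b × PairFuses n d' A c e)

module Submission where

-- Write p i j l for the intersection numbers.  Fusing the classes along a map f gives a scheme iff
-- the fused structure constants, the sums of p i j l over i and j in two fibres of f, are constant
-- on the fibres of f.  If for l ≢ 0 the intersection numbers have the amorphic pattern
-- p i j l = N i j − [l = i] g j − [l = j] g i + [l = i = j] u, these sums depend on l only through
-- the fibre containing l, so every fusion is a scheme.
--
-- Let c be the centre of the claw.  For a leaf x, comparing the structure constants of the fusion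
-- of {c, x} at l = c and at l = x gives p y z c = p y z x for y, z ∉ {c, x}, then
-- p c y c + p x y c = p c y x + p x y x, and an identity for the merged diagonal block.  Since
-- p i j h k_h = tr (A i A j A h) is symmetric in i, j, h, these show that p c y x does not depend
-- on the leaf x ≢ y, that p c c y and p c y y − p c y x do not depend on the leaf y, and the merged
-- diagonal identity becomes the diagonal equation of the pattern at a leaf.  With four classes
-- every nonzero class is the centre or a leaf, so this covers all cases.

open import Defs
open import Data.Fin using (Fin; zero; suc; punchIn; punchOut)
import Data.Fin as F
open import Data.Fin.Patterns using (0F; 1F; 2F; 3F; 4F)
open import Data.Fin.Properties using (punchInᵢ≢i; punchIn-punchOut; all?)
open import Data.Nat using (ℕ; zero; suc; _+_; _*_; _≤_; s≤s; z≤n; NonZero; >-nonZero)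
open import Data.Nat.Properties
  using ( +-*-semiring; *-commutativeSemigroup; ≤-refl; ≤-reflexive; ≤-trans; m≤m+n; n≤1⇒n≡0∨n≡1
        ; +-comm; +-identityʳ; +-mono-≤; +-monoʳ-≤; +-cancelˡ-≡; +-cancelʳ-≡
        ; *-comm; *-assoc; *-identityˡ; *-identityʳ; *-zeroʳ; *-distribˡ-+; *-distribʳ-+; *-cancelˡ-≡; *-cancelʳ-≡
        ; module ≤-Reasoning )
import Data.Nat.Tactic.RingSolver as NatSolver
open import Data.Product using (Σ; ∃-syntax; _×_; _,_; proj₁; proj₂)
open import Data.Sum using (_⊎_; inj₁; inj₂)
open import Function using (_∘_)
open import Function.Bundles using (Equivalence; _⇔_; mk⇔)
open import Relation.Binary.PropositionalEquality
open import Relation.Nullary using (Dec; yes; no; ¬?; contradiction)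
open import Relation.Nullary.Decidable using (_×-dec_; _⊎-dec_; _→-dec_; toWitness)
open import Algebra.Properties.Semiring.Sum +-*-semiring
open import Algebra.Properties.CommutativeSemigroup *-commutativeSemigroup using (x∙yz≈y∙xz; xy∙z≈xz∙y; x∙yz≈z∙yx)

-- Finite sums

Σ≡∑ : ∀ m (t : Fin m → ℕ) → Σ[< m ] t ≡ ∑[ i < m ] t i
Σ≡∑ zero    t = refl
Σ≡∑ (suc m) t = cong (t zero +_) (Σ≡∑ m (t ∘ suc))

Σ[<]-cong : ∀ {m} {t u : Fin m → ℕ} → (∀ i → t i ≡ u i) → Σ[< m ] t ≡ Σ[< m ] u
Σ[<]-cong {m} {t} {u} t≗u = trans (Σ≡∑ m t) (trans (sum-cong-≗ t≗u) (sym (Σ≡∑ m u)))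

∑-pick : ∀ {m} (t : Fin (suc m) → ℕ) l → (∀ i → i ≢ l → t i ≡ 0) → sum t ≡ t l
∑-pick {m} t l others≡0 = begin
  sum t                      ≡⟨ sum-remove t ⟩
  t l + sum (t ∘ punchIn l)  ≡⟨ cong (t l +_) (trans (sum-cong-≗ λ j → others≡0 _ (punchInᵢ≢i l j)) (sum-replicate-zero m)) ⟩
  t l + 0                    ≡⟨ +-identityʳ (t l) ⟩
  t l                        ∎
  where open ≡-Reasoning

∑-≥ : ∀ {m} (t : Fin m → ℕ) l → t l ≤ sum t
∑-≥ {suc _} t l = ≤-trans (m≤m+n (t l) _) (≤-reflexive (sym (sum-remove {i = l} t)))

∑-≥₂ : ∀ {m} (t : Fin (suc m) → ℕ) {l l'} → l ≢ l' → t l + t l' ≤ sum t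
∑-≥₂ t {l} {l'} l≢l' = begin
  t l + t l'                           ≡⟨ cong (λ i → t l + t i) (punchIn-punchOut l≢l') ⟨
  t l + t (punchIn l (punchOut l≢l'))  ≤⟨ +-monoʳ-≤ (t l) (∑-≥ (t ∘ punchIn l) _) ⟩
  t l + sum (t ∘ punchIn l)            ≡⟨ sum-remove t ⟨
  sum t                                ∎
  where open ≤-Reasoning

∑-mono-≤ : ∀ {m} {t u : Fin m → ℕ} → (∀ i → t i ≤ u i) → sum t ≤ sum u
∑-mono-≤ {zero}  t≤u = ≤-refl
∑-mono-≤ {suc m} t≤u = +-mono-≤ (t≤u zero) (∑-mono-≤ (t≤u ∘ suc))

infix 8 _·_
_·_ : ∀ {m} → (Fin m → ℕ) → (Fin m → ℕ) → ℕ
w · t = ∑[ i < _ ] (w i * t i)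

·-congˡ : ∀ {m} {w w' : Fin m → ℕ} (t : Fin m → ℕ) → (∀ i → w i ≡ w' i) → w · t ≡ w' · t
·-congˡ t w≗w' = sum-cong-≗ λ i → cong (_* t i) (w≗w' i)

·-congʳ : ∀ {m} (w : Fin m → ℕ) {t u : Fin m → ℕ} → (∀ i → t i ≡ u i) → w · t ≡ w · u
·-congʳ w t≗u = sum-cong-≗ λ i → cong (w i *_) (t≗u i)

·-+ : ∀ {m} (w t u : Fin m → ℕ) → w · (λ i → t i + u i) ≡ w · t + w · u
·-+ w t u = trans (sum-cong-≗ λ i → *-distribˡ-+ (w i) (t i) (u i)) (∑-distrib-+ (λ i → w i * t i) (λ i → w i * u i))

·-scalar : ∀ {m} (w : Fin m → ℕ) c (t : Fin m → ℕ) → w · (λ i → c * t i) ≡ c * (w · t)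
·-scalar w c t = trans (sum-cong-≗ λ i → x∙yz≈y∙xz (w i) c (t i)) (sym (*-distribˡ-sum c (λ i → w i * t i)))

𝟙 : ∀ {P : Set} → Dec P → ℕ
𝟙 (yes _) = 1
𝟙 (no _)  = 0

δ : ∀ {m} → Fin m → Fin m → ℕ
δ i j = 𝟙 (i F.≟ j)

δ-refl : ∀ {m} (i : Fin m) → δ i i ≡ 1
δ-refl i with i F.≟ i
... | yes _  = refl
... | no i≢i = contradiction refl i≢i

δ-≢ : ∀ {m} {i j : Fin m} → i ≢ j → δ i j ≡ 0
δ-≢ {i = i} {j} i≢j with i F.≟ j
... | yes i≡j = contradiction i≡j i≢j
... | no _    = refl

δ-sym : ∀ {m} (i j : Fin m) → δ i j ≡ δ j i
δ-sym i j with j F.≟ i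
... | yes refl = δ-refl i
... | no j≢i   = δ-≢ (j≢i ∘ sym)

δ-resp : ∀ {m m'} {i j : Fin m} {i' j' : Fin m'} → (i ≡ j ⇔ i' ≡ j') → δ i j ≡ δ i' j'
δ-resp {i = i} {j} {i'} {j'} i≡j⇔i'≡j' with i F.≟ j | i' F.≟ j'
... | yes _   | yes _     = refl
... | no _    | no _      = refl
... | yes i≡j | no i'≢j'  = contradiction (Equivalence.to i≡j⇔i'≡j' i≡j) i'≢j'
... | no i≢j  | yes i'≡j' = contradiction (Equivalence.from i≡j⇔i'≡j' i'≡j') i≢j

δ*≤ : ∀ {m} (i j : Fin m) a → δ i j * a ≤ a
δ*≤ i j a with i F.≟ j
... | yes _ = ≤-reflexive (*-identityˡ a)
... | no _  = z≤n

δ·-pick : ∀ {m} (t : Fin m → ℕ) j → (λ i → δ i j) · t ≡ t j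
δ·-pick {suc _} t j = begin
  (λ i → δ i j) · t  ≡⟨ ∑-pick (λ i → δ i j * t i) j (λ i i≢j → cong (_* t i) (δ-≢ i≢j)) ⟩
  δ j j * t j        ≡⟨ cong (_* t j) (δ-refl j) ⟩
  1 * t j            ≡⟨ *-identityˡ (t j) ⟩
  t j                ∎
  where open ≡-Reasoning

δ₂·-pick : ∀ {m} (t : Fin m → ℕ) {j j'} → j ≢ j' → (λ i → δ i j + δ i j') · t ≡ t j + t j'
δ₂·-pick t {j} {j'} j≢j' = begin
  (λ i → δ i j + δ i j') · t                  ≡⟨ sum-cong-≗ (λ i → *-distribʳ-+ (t i) (δ i j) (δ i j')) ⟩
  ∑[ i < _ ] (δ i j * t i + δ i j' * t i)     ≡⟨ ∑-distrib-+ (λ i → δ i j * t i) (λ i → δ i j' * t i) ⟩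
  (λ i → δ i j) · t + (λ i → δ i j') · t      ≡⟨ cong₂ _+_ (δ·-pick t j) (δ·-pick t j') ⟩
  t j + t j'                                  ∎
  where open ≡-Reasoning

·-δ : ∀ {m} (w : Fin m → ℕ) l c → w · (λ i → δ i l * c) ≡ w l * c
·-δ w l c = trans (sum-cong-≗ λ i → x∙yz≈y∙xz (w i) (δ i l) c) (δ·-pick (λ i → w i * c) l)

⊗-∑ : ∀ {n} (B C : Mat n) x y → (B ⊗ C) x y ≡ ∑[ z < n ] (B x z * C z y)
⊗-∑ {n} B C x y = Σ≡∑ n (λ z → B x z * C z y)

⊗-cong : ∀ {n} {B B' C C' : Mat n} → (∀ x y → B x y ≡ B' x y) → (∀ x y → C x y ≡ C' x y) →
  ∀ x y → (B ⊗ C) x y ≡ (B' ⊗ C') x y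
⊗-cong B≗B' C≗C' x y = Σ[<]-cong λ z → cong₂ _*_ (B≗B' x z) (C≗C' z y)

Id-⊗ : ∀ {n} (B : Mat n) x y → (Id n ⊗ B) x y ≡ B x y
Id-⊗ {n} B x y = trans (⊗-∑ (Id n) B x y) (trans (sum-cong-≗ Id≡δ) (δ·-pick (λ z → B z y) x))
  where
  Id≡δ : ∀ z → Id n x z * B z y ≡ δ z x * B z y
  Id≡δ z with x F.≟ z | z F.≟ x
  ... | yes _   | yes _   = refl
  ... | no _    | no _    = refl
  ... | yes x≡z | no z≢x  = contradiction (sym x≡z) z≢x
  ... | no x≢z  | yes z≡x = contradiction (sym z≡x) x≢z

IsSymAssocScheme-resp : ∀ {n e} {B B' : Fin (suc e) → Mat n} → (∀ k x y → B k x y ≡ B' k x y) →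
  IsSymAssocScheme n e B → IsSymAssocScheme n e B'
IsSymAssocScheme-resp {B = B} {B'} B≗B' S = record
  { zero-one  = λ k x y → subst (λ b → b ≡ 0 ⊎ b ≡ 1) (B≗B' k x y) (zero-one k x y)
  ; nonzero   = λ k → let x , y , Bkxy≡1 = nonzero k in x , y , trans (sym (B≗B' k x y)) Bkxy≡1
  ; A₀≡I      = λ x y → trans (sym (B≗B' zero x y)) (A₀≡I x y)
  ; sum≡J     = λ x y → trans (Σ[<]-cong λ k → sym (B≗B' k x y)) (sum≡J x y)
  ; symmetric = λ k x y → trans (sym (B≗B' k x y)) (trans (symmetric k x y) (B≗B' k y x))
  ; closed    = λ i j → let q , product = closed i j in q , λ x y →
      trans (sym (⊗-cong (B≗B' i) (B≗B' j) x y)) (trans (product x y) (Σ[<]-cong λ h → cong (q h *_) (B≗B' h x y)))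
  }
  where open IsSymAssocScheme S

-- Intersection numbers

module Scheme {n d} {A : Fin (suc d) → Mat n} (S : IsSymAssocScheme n d A) where
  open IsSymAssocScheme S

  p : Fin (suc d) → Fin (suc d) → Fin (suc d) → ℕ
  p i j = proj₁ (closed i j)

  combination : (Fin (suc d) → ℕ) → Mat n
  combination α x y = α · (λ l → A l x y)

  ⊗-combination : ∀ i j x y → (A i ⊗ A j) x y ≡ combination (p i j) x y
  ⊗-combination i j x y = trans (proj₂ (closed i j) x y) (Σ≡∑ (suc d) (λ l → p i j l * A l x y))

  relations-partition : ∀ x y → ∑[ i < suc d ] A i x y ≡ 1
  relations-partition x y = trans (sym (Σ≡∑ (suc d) (λ i → A i x y))) (sum≡J x y)

  other-relations-vanish : ∀ {l h x y} → A l x y ≡ 1 → h ≢ l → A h x y ≡ 0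
  other-relations-vanish {l} {h} {x} {y} Alxy≡1 h≢l with zero-one h x y
  ... | inj₁ Ahxy≡0 = Ahxy≡0
  ... | inj₂ Ahxy≡1 = contradiction
    (subst₂ _≤_ (cong₂ _+_ Ahxy≡1 Alxy≡1) (relations-partition x y) (∑-≥₂ (λ i → A i x y) h≢l))
    λ { (s≤s ()) }

  combination-at : ∀ α {l x y} → A l x y ≡ 1 → combination α x y ≡ α l
  combination-at α {l} {x} {y} Alxy≡1 = begin
    combination α x y  ≡⟨ ∑-pick (λ h → α h * A h x y) l (λ h h≢l → trans (cong (α h *_) (other-relations-vanish Alxy≡1 h≢l)) (*-zeroʳ (α h))) ⟩
    α l * A l x y      ≡⟨ cong (α l *_) Alxy≡1 ⟩
    α l * 1            ≡⟨ *-identityʳ (α l) ⟩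
    α l                ∎
    where open ≡-Reasoning

  combination-injective : ∀ {α β} → (∀ x y → combination α x y ≡ combination β x y) → ∀ l → α l ≡ β l
  combination-injective {α} {β} α≗β l with nonzero l
  ... | x , y , Alxy≡1 = trans (sym (combination-at α Alxy≡1)) (trans (α≗β x y) (combination-at β Alxy≡1))

  combination-mask : ∀ α h x y → combination α x y * A h x y ≡ α h * A h x y
  combination-mask α h x y with zero-one h x y
  ... | inj₁ Ahxy≡0 rewrite Ahxy≡0 = trans (*-zeroʳ (combination α x y)) (sym (*-zeroʳ (α h)))
  ... | inj₂ Ahxy≡1 rewrite Ahxy≡1 = cong (_* 1) (combination-at α Ahxy≡1)

  combination-symmetric : ∀ α x y → combination α x y ≡ combination α y x
  combination-symmetric α x y = ·-congʳ α (λ l → symmetric l x y)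

  ⊗-comm : ∀ i j x y → (A i ⊗ A j) x y ≡ (A j ⊗ A i) x y
  ⊗-comm i j x y = begin
    (A i ⊗ A j) x y                 ≡⟨ ⊗-∑ (A i) (A j) x y ⟩
    ∑[ z < n ] (A i x z * A j z y)  ≡⟨ sum-cong-≗ transpose ⟩
    ∑[ z < n ] (A j y z * A i z x)  ≡⟨ ⊗-∑ (A j) (A i) y x ⟨
    (A j ⊗ A i) y x                 ≡⟨ ⊗-combination j i y x ⟩
    combination (p j i) y x         ≡⟨ combination-symmetric (p j i) y x ⟩
    combination (p j i) x y         ≡⟨ ⊗-combination j i x y ⟨
    (A j ⊗ A i) x y                 ∎
    where
    open ≡-Reasoning
    transpose : ∀ z → A i x z * A j z y ≡ A j y z * A i z x
    transpose z = trans (*-comm (A i x z) _) (cong₂ _*_ (symmetric j z y) (symmetric i x z))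

  p-comm : ∀ i j h → p i j h ≡ p j i h
  p-comm i j = combination-injective λ x y →
    trans (sym (⊗-combination i j x y)) (trans (⊗-comm i j x y) (⊗-combination j i x y))

  p-origin : ∀ j l → p zero j l ≡ δ l j
  p-origin j = combination-injective λ x y → begin
    combination (p zero j) x y         ≡⟨ ⊗-combination zero j x y ⟨
    (A zero ⊗ A j) x y                 ≡⟨ ⊗-cong {C = A j} A₀≡I (λ _ _ → refl) x y ⟩
    (Id n ⊗ A j) x y                   ≡⟨ Id-⊗ (A j) x y ⟩
    A j x y                            ≡⟨ δ·-pick (λ l → A l x y) j ⟨
    combination (λ l → δ l j) x y      ∎
    where open ≡-Reasoning

  -- The number of pairs in relation h, that is n times the usual valency.
  valency : Fin (suc d) → ℕ
  valency h = ∑[ x < n ] ∑[ y < n ] A h x y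

  instance
    valency-nonZero : ∀ {h} → NonZero (valency h)
    valency-nonZero {h} with nonzero h
    ... | x , y , Ahxy≡1 = >-nonZero (≤-trans (≤-reflexive (sym Ahxy≡1))
            (≤-trans (∑-≥ (A h x) y) (∑-≥ (λ x → ∑[ y < n ] A h x y) x)))

  trace : Fin (suc d) → Fin (suc d) → Fin (suc d) → ℕ
  trace i j h = ∑[ x < n ] ∑[ z < n ] (A i x z * (A j ⊗ A h) z x)

  p*valency≡trace : ∀ i j h → p i j h * valency h ≡ trace i j h
  p*valency≡trace i j h = begin
    p i j h * valency h                                            ≡⟨ *-distribˡ-sum (p i j h) (λ x → ∑[ y < n ] A h x y) ⟩
    ∑[ x < n ] (p i j h * ∑[ y < n ] A h x y)                      ≡⟨ sum-cong-≗ (λ x → *-distribˡ-sum (p i j h) (A h x)) ⟩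
    ∑[ x < n ] ∑[ y < n ] (p i j h * A h x y)                      ≡⟨ sum-cong-≗ (λ x → sum-cong-≗ λ y → mask x y) ⟨
    ∑[ x < n ] ∑[ y < n ] ((A i ⊗ A j) x y * A h x y)              ≡⟨ sum-cong-≗ (λ x → sum-cong-≗ λ y → expand x y) ⟩
    ∑[ x < n ] ∑[ y < n ] ∑[ z < n ] (A i x z * A j z y * A h x y) ≡⟨ sum-cong-≗ (λ x → ∑-comm (λ y z → A i x z * A j z y * A h x y)) ⟩
    ∑[ x < n ] ∑[ z < n ] ∑[ y < n ] (A i x z * A j z y * A h x y) ≡⟨ sum-cong-≗ (λ x → sum-cong-≗ λ z → regroup x z) ⟩
    trace i j h                                                    ∎
    where
    open ≡-Reasoning
    mask : ∀ x y → (A i ⊗ A j) x y * A h x y ≡ p i j h * A h x y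
    mask x y = trans (cong (_* A h x y) (⊗-combination i j x y)) (combination-mask (p i j) h x y)
    expand : ∀ x y → (A i ⊗ A j) x y * A h x y ≡ ∑[ z < n ] (A i x z * A j z y * A h x y)
    expand x y = trans (cong (_* A h x y) (⊗-∑ (A i) (A j) x y)) (*-distribʳ-sum (A h x y) (λ z → A i x z * A j z y))
    regroup : ∀ x z → ∑[ y < n ] (A i x z * A j z y * A h x y) ≡ A i x z * (A j ⊗ A h) z x
    regroup x z = begin
      ∑[ y < n ] (A i x z * A j z y * A h x y)    ≡⟨ sum-cong-≗ (λ y → trans (*-assoc (A i x z) _ _) (cong (λ a → A i x z * (A j z y * a)) (symmetric h x y))) ⟩
      ∑[ y < n ] (A i x z * (A j z y * A h y x))  ≡⟨ *-distribˡ-sum (A i x z) (λ y → A j z y * A h y x) ⟨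
      A i x z * ∑[ y < n ] (A j z y * A h y x)    ≡⟨ cong (A i x z *_) (⊗-∑ (A j) (A h) z x) ⟨
      A i x z * (A j ⊗ A h) z x                   ∎

  p+p*valency≡trace : ∀ i j i' j' h → (p i j h + p i' j' h) * valency h ≡ trace i j h + trace i' j' h
  p+p*valency≡trace i j i' j' h =
    trans (*-distribʳ-+ (valency h) (p i j h) (p i' j' h)) (cong₂ _+_ (p*valency≡trace i j h) (p*valency≡trace i' j' h))

  trace-swap : ∀ i j h → trace i j h ≡ trace i h j
  trace-swap i j h = sum-cong-≗ (λ x → sum-cong-≗ λ z → cong (A i x z *_) (⊗-comm j h z x))

  trace-comm : ∀ i j h → trace i j h ≡ trace j i h
  trace-comm i j h = trans (sym (p*valency≡trace i j h)) (trans (cong (_* valency h) (p-comm i j h)) (p*valency≡trace j i h))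

  combination-linear : ∀ {k} (w : Fin k → ℕ) (γ : Fin k → Fin (suc d) → ℕ) x y →
    w · (λ i → combination (γ i) x y) ≡ combination (λ l → w · (λ i → γ i l)) x y
  combination-linear {k} w γ x y = begin
    w · (λ i → combination (γ i) x y)                    ≡⟨ sum-cong-≗ (λ i → *-distribˡ-sum (w i) (λ l → γ i l * A l x y)) ⟩
    ∑[ i < k ] ∑[ l < suc d ] (w i * (γ i l * A l x y))  ≡⟨ ∑-comm (λ i l → w i * (γ i l * A l x y)) ⟩
    ∑[ l < suc d ] ∑[ i < k ] (w i * (γ i l * A l x y))  ≡⟨ sum-cong-≗ (λ l → sum-cong-≗ λ i → *-assoc (w i) (γ i l) (A l x y)) ⟨
    ∑[ l < suc d ] ∑[ i < k ] (w i * γ i l * A l x y)    ≡⟨ sum-cong-≗ (λ l → *-distribʳ-sum (A l x y) (λ i → w i * γ i l)) ⟨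
    combination (λ l → w · (λ i → γ i l)) x y            ∎
    where open ≡-Reasoning

  ⊗-linearˡ : ∀ α (B : Mat n) x y → (combination α ⊗ B) x y ≡ α · (λ i → (A i ⊗ B) x y)
  ⊗-linearˡ α B x y = begin
    (combination α ⊗ B) x y                              ≡⟨ ⊗-∑ (combination α) B x y ⟩
    ∑[ z < n ] (combination α x z * B z y)               ≡⟨ sum-cong-≗ (λ z → *-distribʳ-sum (B z y) (λ i → α i * A i x z)) ⟩
    ∑[ z < n ] ∑[ i < suc d ] (α i * A i x z * B z y)    ≡⟨ ∑-comm (λ z i → α i * A i x z * B z y) ⟩
    ∑[ i < suc d ] ∑[ z < n ] (α i * A i x z * B z y)    ≡⟨ sum-cong-≗ (λ i → sum-cong-≗ λ z → *-assoc (α i) (A i x z) (B z y)) ⟩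
    ∑[ i < suc d ] ∑[ z < n ] (α i * (A i x z * B z y))  ≡⟨ sum-cong-≗ (λ i → *-distribˡ-sum (α i) (λ z → A i x z * B z y)) ⟨
    α · (λ i → ∑[ z < n ] (A i x z * B z y))             ≡⟨ ·-congʳ α (λ i → ⊗-∑ (A i) B x y) ⟨
    α · (λ i → (A i ⊗ B) x y)                            ∎
    where open ≡-Reasoning

  ⊗-linearʳ : ∀ (B : Mat n) β x y → (B ⊗ combination β) x y ≡ β · (λ j → (B ⊗ A j) x y)
  ⊗-linearʳ B β x y = begin
    (B ⊗ combination β) x y                              ≡⟨ ⊗-∑ B (combination β) x y ⟩
    ∑[ z < n ] (B x z * combination β z y)               ≡⟨ sum-cong-≗ (λ z → *-distribˡ-sum (B x z) (λ j → β j * A j z y)) ⟩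
    ∑[ z < n ] ∑[ j < suc d ] (B x z * (β j * A j z y))  ≡⟨ ∑-comm (λ z j → B x z * (β j * A j z y)) ⟩
    ∑[ j < suc d ] ∑[ z < n ] (B x z * (β j * A j z y))  ≡⟨ sum-cong-≗ (λ j → sum-cong-≗ λ z → x∙yz≈y∙xz (B x z) (β j) (A j z y)) ⟩
    ∑[ j < suc d ] ∑[ z < n ] (β j * (B x z * A j z y))  ≡⟨ sum-cong-≗ (λ j → *-distribˡ-sum (β j) (λ z → B x z * A j z y)) ⟨
    β · (λ j → ∑[ z < n ] (B x z * A j z y))             ≡⟨ ·-congʳ β (λ j → ⊗-∑ B (A j) x y) ⟨
    β · (λ j → (B ⊗ A j) x y)                            ∎
    where open ≡-Reasoning

  infixl 7 _⋆_
  _⋆_ : (Fin (suc d) → ℕ) → (Fin (suc d) → ℕ) → Fin (suc d) → ℕ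
  (α ⋆ β) l = α · (λ i → β · (λ j → p i j l))

  combination-⊗ : ∀ α β x y → (combination α ⊗ combination β) x y ≡ combination (α ⋆ β) x y
  combination-⊗ α β x y = begin
    (combination α ⊗ combination β) x y                   ≡⟨ ⊗-linearˡ α (combination β) x y ⟩
    α · (λ i → (A i ⊗ combination β) x y)                 ≡⟨ ·-congʳ α (λ i → ⊗-linearʳ (A i) β x y) ⟩
    α · (λ i → β · (λ j → (A i ⊗ A j) x y))               ≡⟨ ·-congʳ α (λ i → ·-congʳ β λ j → ⊗-combination i j x y) ⟩
    α · (λ i → β · (λ j → combination (p i j) x y))       ≡⟨ ·-congʳ α (λ i → combination-linear β (p i) x y) ⟩
    α · (λ i → combination (λ l → β · (λ j → p i j l)) x y) ≡⟨ combination-linear α (λ i l → β · (λ j → p i j l)) x y ⟩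
    combination (α ⋆ β) x y                               ∎
    where open ≡-Reasoning

  ⋆-cong : ∀ {α α' β β'} → (∀ i → α i ≡ α' i) → (∀ j → β j ≡ β' j) → ∀ l → (α ⋆ β) l ≡ (α' ⋆ β') l
  ⋆-cong α≗α' β≗β' l = sum-cong-≗ λ i → cong₂ _*_ (α≗α' i) (sum-cong-≗ λ j → cong (_* p i j l) (β≗β' j))

  ⋆-δ : ∀ u v l → ((λ i → δ i u) ⋆ (λ j → δ j v)) l ≡ p u v l
  ⋆-δ u v l = trans (δ·-pick (λ i → (λ j → δ j v) · (λ j → p i j l)) u) (δ·-pick (λ j → p u j l) v)

  ⋆-δ₂ : ∀ {c x} → c ≢ x → ∀ v l → ((λ i → δ i c + δ i x) ⋆ (λ j → δ j v)) l ≡ p c v l + p x v l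
  ⋆-δ₂ {c} {x} c≢x v l =
    trans (δ₂·-pick (λ i → (λ j → δ j v) · (λ j → p i j l)) c≢x) (cong₂ _+_ (δ·-pick (λ j → p c j l) v) (δ·-pick (λ j → p x j l) v))

  ⋆-δ₂₂ : ∀ {c x} → c ≢ x → ∀ l →
    ((λ i → δ i c + δ i x) ⋆ (λ j → δ j c + δ j x)) l ≡ (p c c l + p c x l) + (p x c l + p x x l)
  ⋆-δ₂₂ {c} {x} c≢x l =
    trans (δ₂·-pick (λ i → (λ j → δ j c + δ j x) · (λ j → p i j l)) c≢x) (cong₂ _+_ (δ₂·-pick (λ j → p c j l) c≢x) (δ₂·-pick (λ j → p x j l) c≢x))

  -- Fusions

  fibre : ∀ {e} → (Fin (suc d) → Fin (suc e)) → Fin (suc e) → Fin (suc d) → ℕ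
  fibre f k l = δ (f l) k

  fused : ∀ {e} → (Fin (suc d) → Fin (suc e)) → Fin (suc e) → Mat n
  fused f k = combination (fibre f k)

  FibreInvariant : ∀ {e} → (Fin (suc d) → Fin (suc e)) → Set
  FibreInvariant f = ∀ k k' {l l'} → f l ≡ f l' → (fibre f k ⋆ fibre f k') l ≡ (fibre f k ⋆ fibre f k') l'

  module _ {e} (f : Fin (suc d) → Fin (suc e)) where

    ClosedFusion : Set
    ClosedFusion = ∀ k k' → Σ (Fin (suc e) → ℕ) λ q →
      ∀ x y → (fused f k ⊗ fused f k') x y ≡ Σ[< suc e ] (λ h → q h * fused f h x y)

    ∑-fused : ∀ (q : Fin (suc e) → ℕ) x y → q · (λ h → fused f h x y) ≡ combination (q ∘ f) x y
    ∑-fused q x y = begin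
      q · (λ h → fused f h x y)                       ≡⟨ combination-linear q (fibre f) x y ⟩
      combination (λ l → q · (λ h → δ (f l) h)) x y   ≡⟨ ·-congˡ (λ l → A l x y) weight ⟩
      combination (q ∘ f) x y                         ∎
      where
      open ≡-Reasoning
      weight : ∀ l → q · (λ h → δ (f l) h) ≡ q (f l)
      weight l = trans (sum-cong-≗ λ h → trans (*-comm (q h) (δ (f l) h)) (cong (_* q h) (δ-sym (f l) h))) (δ·-pick q (f l))

    closed⇒fibreInvariant : ClosedFusion → FibreInvariant f
    closed⇒fibreInvariant closed-fusion k k' {l} {l'} fl≡fl' = trans (coefficient l) (trans (cong q fl≡fl') (sym (coefficient l')))
      where
      q : Fin (suc e) → ℕ
      q = proj₁ (closed-fusion k k')
      coefficient : ∀ l → (fibre f k ⋆ fibre f k') l ≡ q (f l)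
      coefficient = combination-injective λ x y → begin
        combination (fibre f k ⋆ fibre f k') x y   ≡⟨ combination-⊗ (fibre f k) (fibre f k') x y ⟨
        (fused f k ⊗ fused f k') x y               ≡⟨ proj₂ (closed-fusion k k') x y ⟩
        Σ[< suc e ] (λ h → q h * fused f h x y)    ≡⟨ Σ≡∑ (suc e) (λ h → q h * fused f h x y) ⟩
        q · (λ h → fused f h x y)                  ≡⟨ ∑-fused q x y ⟩
        combination (q ∘ f) x y                    ∎
        where open ≡-Reasoning

    fibreInvariant⇒closed : (∀ k → ∃[ l ] f l ≡ k) → FibreInvariant f → ClosedFusion
    fibreInvariant⇒closed onto invariant k k' = q , λ x y → begin
      (fused f k ⊗ fused f k') x y              ≡⟨ combination-⊗ (fibre f k) (fibre f k') x y ⟩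
      combination (fibre f k ⋆ fibre f k') x y  ≡⟨ ·-congˡ (λ l → A l x y) (λ l → invariant k k' (sym (proj₂ (onto (f l))))) ⟩
      combination (q ∘ f) x y                   ≡⟨ ∑-fused q x y ⟨
      q · (λ h → fused f h x y)                 ≡⟨ Σ≡∑ (suc e) (λ h → q h * fused f h x y) ⟨
      Σ[< suc e ] (λ h → q h * fused f h x y)   ∎
      where
      open ≡-Reasoning
      q : Fin (suc e) → ℕ
      q h = (fibre f k ⋆ fibre f k') (proj₁ (onto h))

    fused-scheme : IsPartitionMap f → FibreInvariant f → IsSymAssocScheme n e (fused f)
    fused-scheme (onto , zero-fibre) invariant = record
      { zero-one  = λ k x y → n≤1⇒n≡0∨n≡1 (fused≤1 k x y)
      ; nonzero   = fused-nonzero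
      ; A₀≡I      = fused-zero
      ; sum≡J     = fused-sum
      ; symmetric = λ k → combination-symmetric (fibre f k)
      ; closed    = fibreInvariant⇒closed onto invariant
      }
      where
      fused≤1 : ∀ k x y → fused f k x y ≤ 1
      fused≤1 k x y = ≤-trans (∑-mono-≤ λ l → δ*≤ (f l) k (A l x y)) (≤-reflexive (relations-partition x y))

      fused-nonzero : ∀ k → ∃[ x ] ∃[ y ] fused f k x y ≡ 1
      fused-nonzero k with onto k
      ... | l , fl≡k with nonzero l
      ...   | x , y , Alxy≡1 = x , y , trans (combination-at (fibre f k) Alxy≡1) (trans (cong (λ k' → δ k' k) fl≡k) (δ-refl k))

      fused-zero : ∀ x y → fused f zero x y ≡ Id n x y
      fused-zero x y = begin
        fused f zero x y                  ≡⟨ ·-congˡ (λ l → A l x y) (λ l → δ-resp (zero-fibre l)) ⟩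
        combination (λ l → δ l zero) x y  ≡⟨ δ·-pick (λ l → A l x y) zero ⟩
        A zero x y                        ≡⟨ A₀≡I x y ⟩
        Id n x y                          ∎
        where open ≡-Reasoning

      fused-sum : ∀ x y → Σ[< suc e ] (λ k → fused f k x y) ≡ 1
      fused-sum x y = begin
        Σ[< suc e ] (λ k → fused f k x y)  ≡⟨ Σ≡∑ (suc e) (λ k → fused f k x y) ⟩
        ∑[ k < suc e ] fused f k x y       ≡⟨ sum-cong-≗ (λ k → *-identityˡ (fused f k x y)) ⟨
        (λ _ → 1) · (λ k → fused f k x y)  ≡⟨ ∑-fused (λ _ → 1) x y ⟩
        combination (λ _ → 1) x y          ≡⟨ sum-cong-≗ (λ l → *-identityˡ (A l x y)) ⟩
        ∑[ l < suc d ] A l x y             ≡⟨ relations-partition x y ⟩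
        1                                  ∎
        where open ≡-Reasoning

  -- What the fusion of the pair {c, x} says about the intersection numbers: the structure
  -- constants of the fused scheme agree at l = c and at l = x.
  record MergeIdentities (c x : Fin (suc d)) : Set where
    field
      distinct    : c ≢ x
      merge-off   : ∀ {w w'} → w ≢ c → w ≢ x → w' ≢ c → w' ≢ x → p w w' c ≡ p w w' x
      merge-mixed : ∀ {w} → w ≢ c → w ≢ x → p c w c + p x w c ≡ p c w x + p x w x
      merge-diag  : (p c c c + p c x c) + (p x c c + p x x c) ≡ (p c c x + p c x x) + (p x c x + p x x x)

  module Merge {e} {f : Fin (suc d) → Fin (suc e)} {c x : Fin (suc d)} (c≢x : c ≢ x)
      (merges : ∀ l l' → (f l ≡ f l') ⇔ (l ≡ l' ⊎ (l ≡ c × l' ≡ x) ⊎ (l ≡ x × l' ≡ c)))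
      (invariant : FibreInvariant f) where

    fc≡fx : f c ≡ f x
    fc≡fx = Equivalence.from (merges c x) (inj₂ (inj₁ (refl , refl)))

    singleton-fibre : ∀ {w} → w ≢ c → w ≢ x → ∀ i → fibre f (f w) i ≡ δ i w
    singleton-fibre {w} w≢c w≢x i = δ-resp (mk⇔ only-w (cong f))
      where
      only-w : f i ≡ f w → i ≡ w
      only-w fi≡fw with Equivalence.to (merges i w) fi≡fw
      ... | inj₁ i≡w              = i≡w
      ... | inj₂ (inj₁ (_ , w≡x)) = contradiction w≡x w≢x
      ... | inj₂ (inj₂ (_ , w≡c)) = contradiction w≡c w≢c

    pair-fibre : ∀ i → fibre f (f c) i ≡ δ i c + δ i x
    pair-fibre i with i F.≟ c | i F.≟ x
    ... | yes refl | yes i≡x  = contradiction i≡x c≢x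
    ... | yes refl | no _     = δ-refl (f i)
    ... | no _     | yes refl = trans (cong (λ k → δ k (f c)) (sym fc≡fx)) (δ-refl (f c))
    ... | no i≢c   | no i≢x   = δ-≢ outside
      where
      outside : f i ≢ f c
      outside fi≡fc with Equivalence.to (merges i c) fi≡fc
      ... | inj₁ i≡c              = i≢c i≡c
      ... | inj₂ (inj₁ (i≡c , _)) = i≢c i≡c
      ... | inj₂ (inj₂ (i≡x , _)) = i≢x i≡x

    merge-off : ∀ {w w'} → w ≢ c → w ≢ x → w' ≢ c → w' ≢ x → p w w' c ≡ p w w' x
    merge-off {w} {w'} w≢c w≢x w'≢c w'≢x = begin
      p w w' c                             ≡⟨ ⋆-δ w w' c ⟨
      ((λ i → δ i w) ⋆ (λ j → δ j w')) c  ≡⟨ ⋆-cong (singleton-fibre w≢c w≢x) (singleton-fibre w'≢c w'≢x) c ⟨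
      (fibre f (f w) ⋆ fibre f (f w')) c   ≡⟨ invariant (f w) (f w') fc≡fx ⟩
      (fibre f (f w) ⋆ fibre f (f w')) x   ≡⟨ ⋆-cong (singleton-fibre w≢c w≢x) (singleton-fibre w'≢c w'≢x) x ⟩
      ((λ i → δ i w) ⋆ (λ j → δ j w')) x  ≡⟨ ⋆-δ w w' x ⟩
      p w w' x                             ∎
      where open ≡-Reasoning

    merge-mixed : ∀ {w} → w ≢ c → w ≢ x → p c w c + p x w c ≡ p c w x + p x w x
    merge-mixed {w} w≢c w≢x = begin
      p c w c + p x w c                           ≡⟨ ⋆-δ₂ c≢x w c ⟨
      ((λ i → δ i c + δ i x) ⋆ (λ j → δ j w)) c  ≡⟨ ⋆-cong pair-fibre (singleton-fibre w≢c w≢x) c ⟨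
      (fibre f (f c) ⋆ fibre f (f w)) c           ≡⟨ invariant (f c) (f w) fc≡fx ⟩
      (fibre f (f c) ⋆ fibre f (f w)) x           ≡⟨ ⋆-cong pair-fibre (singleton-fibre w≢c w≢x) x ⟩
      ((λ i → δ i c + δ i x) ⋆ (λ j → δ j w)) x  ≡⟨ ⋆-δ₂ c≢x w x ⟩
      p c w x + p x w x                           ∎
      where open ≡-Reasoning

    merge-diag : (p c c c + p c x c) + (p x c c + p x x c) ≡ (p c c x + p c x x) + (p x c x + p x x x)
    merge-diag = begin
      (p c c c + p c x c) + (p x c c + p x x c)           ≡⟨ ⋆-δ₂₂ c≢x c ⟨
      ((λ i → δ i c + δ i x) ⋆ (λ j → δ j c + δ j x)) c  ≡⟨ ⋆-cong pair-fibre pair-fibre c ⟨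
      (fibre f (f c) ⋆ fibre f (f c)) c                   ≡⟨ invariant (f c) (f c) fc≡fx ⟩
      (fibre f (f c) ⋆ fibre f (f c)) x                   ≡⟨ ⋆-cong pair-fibre pair-fibre x ⟩
      ((λ i → δ i c + δ i x) ⋆ (λ j → δ j c + δ j x)) x  ≡⟨ ⋆-δ₂₂ c≢x x ⟩
      (p c c x + p c x x) + (p x c x + p x x x)           ∎
      where open ≡-Reasoning

    identities : MergeIdentities c x
    identities = record { distinct = c≢x ; merge-off = merge-off ; merge-mixed = merge-mixed ; merge-diag = merge-diag }

  -- The amorphic pattern

  -- For l ≢ zero, p i j l = N i j − [l = i] g j − [l = j] g i + [l = i = j] u, where the integers
  -- g and u are written as formal differences g⁺ − g⁻ and u⁺ − u⁻ of naturals.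
  record AmorphicPattern : Set where
    field
      N             : Fin (suc d) → Fin (suc d) → ℕ
      g⁺ g⁻         : Fin (suc d) → ℕ
      u⁺ u⁻         : ℕ
      pattern-off   : ∀ {i j l} → l ≢ zero → l ≢ i → l ≢ j → p i j l ≡ N i j
      pattern-left  : ∀ {i j} → i ≢ zero → i ≢ j → p i j i + g⁺ j ≡ N i j + g⁻ j
      pattern-right : ∀ {i j} → j ≢ zero → i ≢ j → p i j j + g⁺ i ≡ N i j + g⁻ i
      pattern-diag  : ∀ {i} → i ≢ zero → p i i i + (g⁺ i + g⁺ i + u⁻) ≡ N i i + (g⁻ i + g⁻ i + u⁺)

  correction : Fin (suc d) → (Fin (suc d) → ℕ) → ℕ → Fin (suc d) → Fin (suc d) → ℕ
  correction l h v i j = δ i l * h j + δ j l * h i + δ i l * (δ j l * v)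

  correction-expansion : ∀ (α β : Fin (suc d) → ℕ) (M : Fin (suc d) → Fin (suc d) → ℕ) l h v →
    α · (λ i → β · (λ j → M i j + correction l h v i j)) ≡ α · (λ i → β · M i) + (α l * (β · h) + β l * (α · h) + α l * (β l * v))
  correction-expansion α β M l h v = begin
    α · (λ i → β · (λ j → M i j + correction l h v i j))                              ≡⟨ ·-congʳ α inner ⟩
    α · (λ i → β · M i + (δ i l * (β · h) + β l * h i + δ i l * (β l * v)))            ≡⟨ ·-+ α (λ i → β · M i) (λ i → δ i l * (β · h) + β l * h i + δ i l * (β l * v)) ⟩
    α · (λ i → β · M i) + α · (λ i → δ i l * (β · h) + β l * h i + δ i l * (β l * v))  ≡⟨ cong (α · (λ i → β · M i) +_) outer ⟩
    α · (λ i → β · M i) + (α l * (β · h) + β l * (α · h) + α l * (β l * v))            ∎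
    where
    open ≡-Reasoning
    inner : ∀ i → β · (λ j → M i j + correction l h v i j) ≡ β · M i + (δ i l * (β · h) + β l * h i + δ i l * (β l * v))
    inner i = begin
      β · (λ j → M i j + correction l h v i j)
        ≡⟨ ·-+ β (M i) (correction l h v i) ⟩
      β · M i + β · correction l h v i
        ≡⟨ cong (β · M i +_) (·-+ β (λ j → δ i l * h j + δ j l * h i) (λ j → δ i l * (δ j l * v))) ⟩
      β · M i + (β · (λ j → δ i l * h j + δ j l * h i) + β · (λ j → δ i l * (δ j l * v)))
        ≡⟨ cong (β · M i +_) (cong₂ _+_ (·-+ β (λ j → δ i l * h j) (λ j → δ j l * h i)) (·-scalar β (δ i l) (λ j → δ j l * v))) ⟩
      β · M i + (β · (λ j → δ i l * h j) + β · (λ j → δ j l * h i) + δ i l * (β · (λ j → δ j l * v)))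
        ≡⟨ cong (β · M i +_) (cong₂ _+_ (cong₂ _+_ (·-scalar β (δ i l) h) (·-δ β l (h i))) (cong (δ i l *_) (·-δ β l v))) ⟩
      β · M i + (δ i l * (β · h) + β l * h i + δ i l * (β l * v))
        ∎
    outer : α · (λ i → δ i l * (β · h) + β l * h i + δ i l * (β l * v)) ≡ α l * (β · h) + β l * (α · h) + α l * (β l * v)
    outer = begin
      α · (λ i → δ i l * (β · h) + β l * h i + δ i l * (β l * v))
        ≡⟨ ·-+ α (λ i → δ i l * (β · h) + β l * h i) (λ i → δ i l * (β l * v)) ⟩
      α · (λ i → δ i l * (β · h) + β l * h i) + α · (λ i → δ i l * (β l * v))
        ≡⟨ cong₂ _+_ (·-+ α (λ i → δ i l * (β · h)) (λ i → β l * h i)) (·-δ α l (β l * v)) ⟩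
      α · (λ i → δ i l * (β · h)) + α · (λ i → β l * h i) + α l * (β l * v)
        ≡⟨ cong (_+ α l * (β l * v)) (cong₂ _+_ (·-δ α l (β · h)) (·-scalar α (β l) h)) ⟩
      α l * (β · h) + β l * (α · h) + α l * (β l * v)
        ∎

  module _ (P : AmorphicPattern) where
    open AmorphicPattern P

    pattern-correction : ∀ {l} → l ≢ zero → ∀ i j → p i j l + correction l g⁺ u⁻ i j ≡ N i j + correction l g⁻ u⁺ i j
    pattern-correction {l} l≢0 i j with i F.≟ l | j F.≟ l
    ... | no i≢l   | no j≢l   = cong (_+ 0) (pattern-off l≢0 (i≢l ∘ sym) (j≢l ∘ sym))
    ... | yes refl | no j≢l   = begin
      p l j l + (g⁺ j + 0 + 0 + 0)  ≡⟨ cong (p l j l +_) (x+0+0+0≡x (g⁺ j)) ⟩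
      p l j l + g⁺ j                ≡⟨ pattern-left l≢0 (j≢l ∘ sym) ⟩
      N l j + g⁻ j                  ≡⟨ cong (N l j +_) (x+0+0+0≡x (g⁻ j)) ⟨
      N l j + (g⁻ j + 0 + 0 + 0)    ∎
      where
      open ≡-Reasoning
      x+0+0+0≡x : ∀ x → x + 0 + 0 + 0 ≡ x
      x+0+0+0≡x = NatSolver.solve-∀
    ... | no i≢l   | yes refl = begin
      p i l l + (g⁺ i + 0 + 0)      ≡⟨ cong (p i l l +_) (x+0+0≡x (g⁺ i)) ⟩
      p i l l + g⁺ i                ≡⟨ pattern-right l≢0 i≢l ⟩
      N i l + g⁻ i                  ≡⟨ cong (N i l +_) (x+0+0≡x (g⁻ i)) ⟨
      N i l + (g⁻ i + 0 + 0)        ∎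
      where
      open ≡-Reasoning
      x+0+0≡x : ∀ x → x + 0 + 0 ≡ x
      x+0+0≡x = NatSolver.solve-∀
    ... | yes refl | yes refl = begin
      p l l l + (g⁺ l + 0 + (g⁺ l + 0) + (u⁻ + 0 + 0))  ≡⟨ cong (p l l l +_) (normalise (g⁺ l) u⁻) ⟩
      p l l l + (g⁺ l + g⁺ l + u⁻)                      ≡⟨ pattern-diag l≢0 ⟩
      N l l + (g⁻ l + g⁻ l + u⁺)                        ≡⟨ cong (N l l +_) (normalise (g⁻ l) u⁺) ⟨
      N l l + (g⁻ l + 0 + (g⁻ l + 0) + (u⁺ + 0 + 0))    ∎
      where
      open ≡-Reasoning
      normalise : ∀ x y → x + 0 + (x + 0) + (y + 0 + 0) ≡ x + x + y
      normalise = NatSolver.solve-∀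

    coefficient-pattern : ∀ α β {l} → l ≢ zero →
      (α ⋆ β) l + (α l * (β · g⁺) + β l * (α · g⁺) + α l * (β l * u⁻)) ≡
      α · (λ i → β · N i) + (α l * (β · g⁻) + β l * (α · g⁻) + α l * (β l * u⁺))
    coefficient-pattern α β {l} l≢0 = begin
      (α ⋆ β) l + (α l * (β · g⁺) + β l * (α · g⁺) + α l * (β l * u⁻))           ≡⟨ correction-expansion α β (λ i j → p i j l) l g⁺ u⁻ ⟨
      α · (λ i → β · (λ j → p i j l + correction l g⁺ u⁻ i j))                    ≡⟨ ·-congʳ α (λ i → ·-congʳ β (pattern-correction l≢0 i)) ⟩
      α · (λ i → β · (λ j → N i j + correction l g⁻ u⁺ i j))                      ≡⟨ correction-expansion α β N l g⁻ u⁺ ⟩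
      α · (λ i → β · N i) + (α l * (β · g⁻) + β l * (α · g⁻) + α l * (β l * u⁺))  ∎
      where open ≡-Reasoning

    pattern⇒fibreInvariant : ∀ {e} (f : Fin (suc d) → Fin (suc e)) → (∀ l → (f l ≡ zero) ⇔ (l ≡ zero)) → FibreInvariant f
    pattern⇒fibreInvariant f zero-fibre k k' {l} {l'} fl≡fl' with l F.≟ zero | l' F.≟ zero
    ... | yes refl | yes refl = refl
    ... | yes refl | no l'≢0  = contradiction (Equivalence.to (zero-fibre l') (trans (sym fl≡fl') (Equivalence.from (zero-fibre zero) refl))) l'≢0
    ... | no l≢0   | yes refl = contradiction (Equivalence.to (zero-fibre l) (trans fl≡fl' (Equivalence.from (zero-fibre zero) refl))) l≢0
    ... | no l≢0   | no l'≢0  = +-cancelʳ-≡ (C⁺ (α l) (β l)) _ _ (begin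
      (α ⋆ β) l + C⁺ (α l) (β l)              ≡⟨ coefficient-pattern α β l≢0 ⟩
      α · (λ i → β · N i) + C⁻ (α l) (β l)    ≡⟨ cong₂ (λ a b → α · (λ i → β · N i) + C⁻ a b) same-α same-β ⟩
      α · (λ i → β · N i) + C⁻ (α l') (β l')  ≡⟨ coefficient-pattern α β l'≢0 ⟨
      (α ⋆ β) l' + C⁺ (α l') (β l')           ≡⟨ cong₂ (λ a b → (α ⋆ β) l' + C⁺ a b) same-α same-β ⟨
      (α ⋆ β) l' + C⁺ (α l) (β l)             ∎)
      where
      open ≡-Reasoning
      α β : Fin (suc d) → ℕ
      α = fibre f k
      β = fibre f k'
      C⁺ C⁻ : ℕ → ℕ → ℕ
      C⁺ a b = a * (β · g⁺) + b * (α · g⁺) + a * (b * u⁻)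
      C⁻ a b = a * (β · g⁻) + b * (α · g⁻) + a * (b * u⁺)
      same-α : α l ≡ α l'
      same-α = cong (λ m → δ m k) fl≡fl'
      same-β : β l ≡ β l'
      same-β = cong (λ m → δ m k') fl≡fl'

  -- A claw in the fusing-relations graph

  module Star {c a b e : Fin (suc d)} (a≢b : a ≢ b) (a≢e : a ≢ e) (b≢e : b ≢ e)
              (merge-a : MergeIdentities c a) (merge-b : MergeIdentities c b) (merge-e : MergeIdentities c e) where

    Leaf : Fin (suc d) → Set
    Leaf x = x ≡ a ⊎ x ≡ b ⊎ x ≡ e

    merging : ∀ {x} → Leaf x → MergeIdentities c x
    merging (inj₁ refl)        = merge-a
    merging (inj₂ (inj₁ refl)) = merge-b
    merging (inj₂ (inj₂ refl)) = merge-e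

    leaf≢c : ∀ {x} → Leaf x → x ≢ c
    leaf≢c leaf-x = MergeIdentities.distinct (merging leaf-x) ∘ sym

    third-leaf : ∀ y z → ∃[ x ] Leaf x × x ≢ y × x ≢ z
    third-leaf y z with a F.≟ y | a F.≟ z | b F.≟ y | b F.≟ z
    ... | no a≢y  | no a≢z  | _       | _       = a , inj₁ refl , a≢y , a≢z
    ... | _       | _       | no b≢y  | no b≢z  = b , inj₂ (inj₁ refl) , b≢y , b≢z
    ... | yes a≡y | _       | yes b≡y | _       = contradiction (trans a≡y (sym b≡y)) a≢b
    ... | _       | yes a≡z | _       | yes b≡z = contradiction (trans a≡z (sym b≡z)) a≢b
    ... | yes a≡y | _       | _       | yes b≡z =
      e , inj₂ (inj₂ refl) , (λ e≡y → a≢e (trans a≡y (sym e≡y))) , (λ e≡z → b≢e (trans b≡z (sym e≡z)))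
    ... | _       | yes a≡z | yes b≡y | _       =
      e , inj₂ (inj₂ refl) , (λ e≡y → b≢e (trans b≡y (sym e≡y))) , (λ e≡z → a≢e (trans a≡z (sym e≡z)))

    merge-off-trace : ∀ {x y z} → Leaf x → y ≢ c → y ≢ x → z ≢ c → z ≢ x → trace y z c * valency x ≡ trace y z x * valency c
    merge-off-trace {x} {y} {z} leaf-x y≢c y≢x z≢c z≢x = begin
      trace y z c * valency x           ≡⟨ cong (_* valency x) (p*valency≡trace y z c) ⟨
      p y z c * valency c * valency x   ≡⟨ cong (λ q → q * valency c * valency x) (MergeIdentities.merge-off (merging leaf-x) y≢c y≢x z≢c z≢x) ⟩
      p y z x * valency c * valency x   ≡⟨ xy∙z≈xz∙y (p y z x) (valency c) (valency x) ⟩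
      p y z x * valency x * valency c   ≡⟨ cong (_* valency c) (p*valency≡trace y z x) ⟩
      trace y z x * valency c           ∎
      where open ≡-Reasoning

    centre-leaf-off : ∀ {x y z} → Leaf x → Leaf y → Leaf z → x ≢ y → z ≢ y → p c y x ≡ p c y z
    centre-leaf-off {x} {y} {z} leaf-x leaf-y leaf-z x≢y z≢y with x F.≟ z
    ... | yes refl = refl
    ... | no x≢z   = *-cancelʳ-≡ _ _ (valency x) (*-cancelʳ-≡ _ _ (valency z) (begin
      p c y x * valency x * valency z   ≡⟨ cong (_* valency z) (p*valency≡trace c y x) ⟩
      trace c y x * valency z           ≡⟨ cong (_* valency z) (trans (trace-comm c y x) (trace-swap y c x)) ⟩
      trace y x c * valency z           ≡⟨ merge-off-trace leaf-z (leaf≢c leaf-y) (z≢y ∘ sym) (leaf≢c leaf-x) x≢z ⟩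
      trace y x z * valency c           ≡⟨ cong (_* valency c) (trace-swap y x z) ⟩
      trace y z x * valency c           ≡⟨ merge-off-trace leaf-x (leaf≢c leaf-y) (x≢y ∘ sym) (leaf≢c leaf-z) (x≢z ∘ sym) ⟨
      trace y z c * valency x           ≡⟨ cong (_* valency x) (trans (trace-swap y z c) (trace-comm y c z)) ⟩
      trace c y z * valency x           ≡⟨ cong (_* valency x) (p*valency≡trace c y z) ⟨
      p c y z * valency z * valency x   ≡⟨ xy∙z≈xz∙y (p c y z) (valency z) (valency x) ⟩
      p c y z * valency x * valency z   ∎))
      where open ≡-Reasoning

    centre-mixed-trace : ∀ {x y} → Leaf x → Leaf y → x ≢ y →
      valency x * (trace c c y + trace c x y) ≡ valency c * trace c x y + valency y * trace c x x
    centre-mixed-trace {x} {y} leaf-x leaf-y x≢y = begin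
      valency x * (trace c c y + trace c x y)                     ≡⟨ cong (valency x *_) (cong₂ _+_ (trace-swap c y c) (trans (trace-swap x y c) (trace-comm x c y))) ⟨
      valency x * (trace c y c + trace x y c)                     ≡⟨ cong (valency x *_) (p+p*valency≡trace c y x y c) ⟨
      valency x * ((p c y c + p x y c) * valency c)               ≡⟨ cong (λ q → valency x * (q * valency c)) (MergeIdentities.merge-mixed (merging leaf-x) (leaf≢c leaf-y) (x≢y ∘ sym)) ⟩
      valency x * ((p c y x + p x y x) * valency c)               ≡⟨ x∙yz≈z∙yx (valency x) (p c y x + p x y x) (valency c) ⟩
      valency c * ((p c y x + p x y x) * valency x)               ≡⟨ cong (valency c *_) (p+p*valency≡trace c y x y x) ⟩
      valency c * (trace c y x + trace x y x)                     ≡⟨ cong (valency c *_) (cong₂ _+_ (trace-swap c y x) (trace-swap x y x)) ⟩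
      valency c * (trace c x y + trace x x y)                     ≡⟨ *-distribˡ-+ (valency c) (trace c x y) (trace x x y) ⟩
      valency c * trace c x y + valency c * trace x x y           ≡⟨ cong (valency c * trace c x y +_) leaf-trace ⟩
      valency c * trace c x y + valency y * trace c x x           ∎
      where
      open ≡-Reasoning
      leaf-trace : valency c * trace x x y ≡ valency y * trace c x x
      leaf-trace = begin
        valency c * trace x x y   ≡⟨ *-comm (valency c) (trace x x y) ⟩
        trace x x y * valency c   ≡⟨ merge-off-trace leaf-y (leaf≢c leaf-x) x≢y (leaf≢c leaf-x) x≢y ⟨
        trace x x c * valency y   ≡⟨ cong (_* valency y) (trans (trace-swap x x c) (trace-comm x c x)) ⟩
        trace c x x * valency y   ≡⟨ *-comm (trace c x x) (valency y) ⟩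
        valency y * trace c x x   ∎

    centre-mixed : ∀ {x y} → Leaf x → Leaf y → x ≢ y → valency x * (p c c y + p c x y) ≡ valency c * p c x y + valency x * p c x x
    centre-mixed {x} {y} leaf-x leaf-y x≢y = *-cancelʳ-≡ _ _ (valency y) (begin
      valency x * (p c c y + p c x y) * valency y                   ≡⟨ *-assoc (valency x) _ (valency y) ⟩
      valency x * ((p c c y + p c x y) * valency y)                 ≡⟨ cong (valency x *_) (p+p*valency≡trace c c c x y) ⟩
      valency x * (trace c c y + trace c x y)                       ≡⟨ centre-mixed-trace leaf-x leaf-y x≢y ⟩
      valency c * trace c x y + valency y * trace c x x             ≡⟨ cong₂ (λ q r → valency c * q + valency y * r) (p*valency≡trace c x y) (p*valency≡trace c x x) ⟨
      valency c * (p c x y * valency y) + valency y * (p c x x * valency x) ≡⟨ regroup (valency c) (p c x y) (valency y) (p c x x) (valency x) ⟩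
      (valency c * p c x y + valency x * p c x x) * valency y       ∎)
      where
      open ≡-Reasoning
      regroup : ∀ m s m' q m'' → m * (s * m') + m' * (q * m'') ≡ (m * s + m'' * q) * m'
      regroup = NatSolver.solve-∀

    centre-diag : ∀ {y z} → Leaf y → Leaf z → p c c y ≡ p c c z
    centre-diag {y} {z} leaf-y leaf-z with y F.≟ z | third-leaf y z
    ... | yes refl | _ = refl
    ... | no y≢z   | x , leaf-x , x≢y , x≢z = +-cancelʳ-≡ (p c x y) _ _ (*-cancelˡ-≡ _ _ (valency x) (begin
      valency x * (p c c y + p c x y)            ≡⟨ centre-mixed leaf-x leaf-y x≢y ⟩
      valency c * p c x y + valency x * p c x x  ≡⟨ cong (λ s → valency c * s + valency x * p c x x) same-off ⟩
      valency c * p c x z + valency x * p c x x  ≡⟨ centre-mixed leaf-x leaf-z x≢z ⟨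
      valency x * (p c c z + p c x z)            ≡⟨ cong (λ s → valency x * (p c c z + s)) same-off ⟨
      valency x * (p c c z + p c x y)            ∎))
      where
      open ≡-Reasoning
      same-off : p c x y ≡ p c x z
      same-off = centre-leaf-off leaf-y leaf-x leaf-z (x≢y ∘ sym) (x≢z ∘ sym)

    centre-leaf-diag : ∀ {x y} → Leaf x → Leaf y → p c x x + p c y x ≡ p c y y + p c x y
    centre-leaf-diag {x} {y} leaf-x leaf-y with x F.≟ y
    ... | yes refl = refl
    ... | no x≢y   = cancel (+-cancelˡ-≡ (valency c * T) _ _ (begin
      valency c * T + valency y * (trace c x x + T)              ≡⟨ regroup (valency c * T) (valency y) (trace c x x) T ⟩
      valency c * T + valency y * trace c x x + valency y * T    ≡⟨ cong (_+ valency y * T) (centre-mixed-trace leaf-x leaf-y x≢y) ⟨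
      valency x * (trace c c y + T) + valency y * T              ≡⟨ cong (λ q → valency x * (q + T) + valency y * T) (p*valency≡trace c c y) ⟨
      valency x * (p c c y * valency y + T) + valency y * T      ≡⟨ exchange (valency x) (valency y) (p c c y) T ⟩
      valency y * (p c c y * valency x + T) + valency x * T      ≡⟨ cong (λ q → valency y * (q * valency x + T) + valency x * T) (centre-diag leaf-y leaf-x) ⟩
      valency y * (p c c x * valency x + T) + valency x * T      ≡⟨ cong (λ q → valency y * (q + T) + valency x * T) (p*valency≡trace c c x) ⟩
      valency y * (trace c c x + T) + valency x * T              ≡⟨ cong (λ q → valency y * (trace c c x + q) + valency x * T) (trace-swap c x y) ⟩
      valency y * (trace c c x + trace c y x) + valency x * T    ≡⟨ cong (_+ valency x * T) (centre-mixed-trace leaf-y leaf-x (x≢y ∘ sym)) ⟩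
      valency c * trace c y x + valency x * trace c y y + valency x * T ≡⟨ cong (λ q → valency c * q + valency x * trace c y y + valency x * T) (trace-swap c x y) ⟨
      valency c * T + valency x * trace c y y + valency x * T    ≡⟨ regroup (valency c * T) (valency x) (trace c y y) T ⟨
      valency c * T + valency x * (trace c y y + T)              ∎))
      where
      open ≡-Reasoning
      T : ℕ
      T = trace c x y
      regroup : ∀ C m q r → C + m * (q + r) ≡ C + m * q + m * r
      regroup = NatSolver.solve-∀
      exchange : ∀ m m' q r → m * (q * m' + r) + m' * r ≡ m' * (q * m + r) + m * r
      exchange = NatSolver.solve-∀
      cancel : valency y * (trace c x x + T) ≡ valency x * (trace c y y + T) → p c x x + p c y x ≡ p c y y + p c x y
      cancel eq = *-cancelʳ-≡ _ _ (valency x) (*-cancelʳ-≡ _ _ (valency y) (begin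
        (p c x x + p c y x) * valency x * valency y   ≡⟨ cong (_* valency y) (p+p*valency≡trace c x c y x) ⟩
        (trace c x x + trace c y x) * valency y       ≡⟨ cong (λ q → (trace c x x + q) * valency y) (trace-swap c x y) ⟨
        (trace c x x + T) * valency y                 ≡⟨ *-comm (trace c x x + T) (valency y) ⟩
        valency y * (trace c x x + T)                 ≡⟨ eq ⟩
        valency x * (trace c y y + T)                 ≡⟨ *-comm (valency x) (trace c y y + T) ⟩
        (trace c y y + T) * valency x                 ≡⟨ cong (_* valency x) (p+p*valency≡trace c y c x y) ⟨
        (p c y y + p c x y) * valency y * valency x   ≡⟨ xy∙z≈xz∙y (p c y y + p c x y) (valency y) (valency x) ⟩
        (p c y y + p c x y) * valency x * valency y   ∎))

    other : Fin (suc d) → Fin (suc d)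
    other y = proj₁ (third-leaf y y)

    off : Fin (suc d) → ℕ
    off y = p c y (other y)

    off-value : ∀ {y l} → Leaf y → Leaf l → l ≢ y → p c y l ≡ off y
    off-value {y} leaf-y leaf-l l≢y =
      let leaf-o , o≢y , _ = proj₂ (third-leaf y y) in centre-leaf-off leaf-l leaf-y leaf-o l≢y o≢y

    centre-leaf-diag-off : ∀ {i} → Leaf i → p c i i + off a ≡ p c a a + off i
    centre-leaf-diag-off {i} leaf-i with i F.≟ a
    ... | yes refl = refl
    ... | no i≢a   = begin
      p c i i + off a     ≡⟨ cong (p c i i +_) (off-value (inj₁ refl) leaf-i i≢a) ⟨
      p c i i + p c a i   ≡⟨ centre-leaf-diag leaf-i (inj₁ refl) ⟩
      p c a a + p c i a   ≡⟨ cong (p c a a +_) (off-value leaf-i (inj₁ refl) (i≢a ∘ sym)) ⟩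
      p c a a + off i     ∎
      where open ≡-Reasoning

    leaf-diagonal : ∀ {i} → Leaf i →
      p i i i + (off i + off i + (p c a a + p c a a + p c c a)) ≡ p i i c + (p c i c + p c i c + (p c c c + off a + off a))
    leaf-diagonal {i} leaf-i = begin
      p i i i + (off i + off i + (p c a a + p c a a + p c c a))         ≡⟨ regroup₁ (p i i i) (off i) (p c a a) (p c c a) ⟩
      p i i i + p c c a + (p c a a + off i) + (p c a a + off i)         ≡⟨ cong₂ (λ q r → p i i i + p c c a + q + r) (centre-leaf-diag-off leaf-i) (centre-leaf-diag-off leaf-i) ⟨
      p i i i + p c c a + (p c i i + off a) + (p c i i + off a)         ≡⟨ regroup₂ (p i i i) (p c c a) (p c i i) (off a) ⟩
      (p c c a + p c i i) + (p c i i + p i i i) + off a + off a         ≡⟨ cong (λ q → (q + p c i i) + (p c i i + p i i i) + off a + off a) (centre-diag leaf-i (inj₁ refl)) ⟨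
      (p c c i + p c i i) + (p c i i + p i i i) + off a + off a         ≡⟨ cong (λ q → (p c c i + p c i i) + (q + p i i i) + off a + off a) (p-comm c i i) ⟩
      (p c c i + p c i i) + (p i c i + p i i i) + off a + off a         ≡⟨ cong (λ q → q + off a + off a) (MergeIdentities.merge-diag (merging leaf-i)) ⟨
      (p c c c + p c i c) + (p i c c + p i i c) + off a + off a         ≡⟨ cong (λ q → (p c c c + p c i c) + (q + p i i c) + off a + off a) (p-comm i c c) ⟩
      (p c c c + p c i c) + (p c i c + p i i c) + off a + off a         ≡⟨ regroup₃ (p c c c) (p c i c) (p i i c) (off a) ⟩
      p i i c + (p c i c + p c i c + (p c c c + off a + off a))         ∎
      where
      open ≡-Reasoning
      regroup₁ : ∀ X O P C → X + (O + O + (P + P + C)) ≡ X + C + (P + O) + (P + O)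
      regroup₁ = NatSolver.solve-∀
      regroup₂ : ∀ X C Q O → X + C + (Q + O) + (Q + O) ≡ (C + Q) + (Q + X) + O + O
      regroup₂ = NatSolver.solve-∀
      regroup₃ : ∀ C Z Y O → (C + Z) + (Z + Y) + O + O ≡ Y + (Z + Z + (C + O + O))
      regroup₃ = NatSolver.solve-∀

    module _ (cover : ∀ i → i ≡ zero ⊎ i ≡ c ⊎ Leaf i) where

      star-N : Fin (suc d) → Fin (suc d) → ℕ
      star-N i j with cover i | cover j
      ... | inj₁ _        | _             = 0
      ... | inj₂ _        | inj₁ _        = 0
      ... | inj₂ (inj₁ _) | inj₂ (inj₁ _) = p c c a
      ... | inj₂ (inj₁ _) | inj₂ (inj₂ _) = off j
      ... | inj₂ (inj₂ _) | inj₂ (inj₁ _) = off i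
      ... | inj₂ (inj₂ _) | inj₂ (inj₂ _) = p i j c

      star-g⁺ star-g⁻ : Fin (suc d) → ℕ
      star-g⁺ i with cover i
      ... | inj₁ _        = 0
      ... | inj₂ (inj₁ _) = off a
      ... | inj₂ (inj₂ _) = off i
      star-g⁻ i with cover i
      ... | inj₁ _        = 1
      ... | inj₂ (inj₁ _) = p c a a
      ... | inj₂ (inj₂ _) = p c i c

      star-N-sym : ∀ i j → star-N i j ≡ star-N j i
      star-N-sym i j with cover i | cover j
      ... | inj₁ _        | inj₁ _        = refl
      ... | inj₁ _        | inj₂ _        = refl
      ... | inj₂ _        | inj₁ _        = refl
      ... | inj₂ (inj₁ _) | inj₂ (inj₁ _) = refl
      ... | inj₂ (inj₁ _) | inj₂ (inj₂ _) = refl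
      ... | inj₂ (inj₂ _) | inj₂ (inj₁ _) = refl
      ... | inj₂ (inj₂ _) | inj₂ (inj₂ _) = p-comm i j c

      star-off : ∀ {i j l} → l ≢ zero → l ≢ i → l ≢ j → p i j l ≡ star-N i j
      star-off {i} {j} {l} l≢0 l≢i l≢j with cover i | cover j | cover l
      ... | _                  | _                  | inj₁ l≡0          = contradiction l≡0 l≢0
      ... | inj₁ refl          | _                  | _                  = trans (p-origin j l) (δ-≢ l≢j)
      ... | inj₂ _             | inj₁ refl          | _                  = trans (p-comm i zero l) (trans (p-origin i l) (δ-≢ l≢i))
      ... | inj₂ (inj₁ refl)   | _                  | inj₂ (inj₁ refl)   = contradiction refl l≢i
      ... | inj₂ (inj₂ _)      | inj₂ (inj₁ refl)   | inj₂ (inj₁ refl)   = contradiction refl l≢j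
      ... | inj₂ (inj₁ refl)   | inj₂ (inj₁ refl)   | inj₂ (inj₂ leaf-l) = centre-diag leaf-l (inj₁ refl)
      ... | inj₂ (inj₁ refl)   | inj₂ (inj₂ leaf-j) | inj₂ (inj₂ leaf-l) = off-value leaf-j leaf-l l≢j
      ... | inj₂ (inj₂ leaf-i) | inj₂ (inj₁ refl)   | inj₂ (inj₂ leaf-l) = trans (p-comm i c l) (off-value leaf-i leaf-l l≢i)
      ... | inj₂ (inj₂ leaf-i) | inj₂ (inj₂ leaf-j) | inj₂ (inj₁ refl)   = refl
      ... | inj₂ (inj₂ leaf-i) | inj₂ (inj₂ leaf-j) | inj₂ (inj₂ leaf-l) =
        sym (MergeIdentities.merge-off (merging leaf-l) (leaf≢c leaf-i) (l≢i ∘ sym) (leaf≢c leaf-j) (l≢j ∘ sym))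

      star-left : ∀ {i j} → i ≢ zero → i ≢ j → p i j i + star-g⁺ j ≡ star-N i j + star-g⁻ j
      star-left {i} {j} i≢0 i≢j with cover i | cover j
      ... | inj₁ i≡0           | _                  = contradiction i≡0 i≢0
      ... | inj₂ _             | inj₁ refl          = trans (+-identityʳ _) (trans (p-comm i zero i) (trans (p-origin i i) (δ-refl i)))
      ... | inj₂ (inj₁ refl)   | inj₂ (inj₁ refl)   = contradiction refl i≢j
      ... | inj₂ (inj₁ refl)   | inj₂ (inj₂ leaf-j) = +-comm (p c j c) (off j)
      ... | inj₂ (inj₂ leaf-i) | inj₂ (inj₁ refl)   = trans (cong (_+ off a) (p-comm i c i)) (trans (centre-leaf-diag-off leaf-i) (+-comm (p c a a) (off i)))
      ... | inj₂ (inj₂ leaf-i) | inj₂ (inj₂ leaf-j) = begin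
        p i j i + off j       ≡⟨ cong (p i j i +_) (off-value leaf-j leaf-i i≢j) ⟨
        p i j i + p c j i     ≡⟨ +-comm (p i j i) (p c j i) ⟩
        p c j i + p i j i     ≡⟨ MergeIdentities.merge-mixed (merging leaf-i) (leaf≢c leaf-j) (i≢j ∘ sym) ⟨
        p c j c + p i j c     ≡⟨ +-comm (p c j c) (p i j c) ⟩
        p i j c + p c j c     ∎
        where open ≡-Reasoning

      star-right : ∀ {i j} → j ≢ zero → i ≢ j → p i j j + star-g⁺ i ≡ star-N i j + star-g⁻ i
      star-right {i} {j} j≢0 i≢j =
        trans (cong (_+ star-g⁺ i) (p-comm i j j)) (trans (star-left j≢0 (i≢j ∘ sym)) (cong (_+ star-g⁻ i) (star-N-sym j i)))

      star-diag : ∀ {i} → i ≢ zero →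
        p i i i + (star-g⁺ i + star-g⁺ i + (p c a a + p c a a + p c c a)) ≡ star-N i i + (star-g⁻ i + star-g⁻ i + (p c c c + off a + off a))
      star-diag {i} i≢0 with cover i
      ... | inj₁ i≡0           = contradiction i≡0 i≢0
      ... | inj₂ (inj₁ refl)   = regroup (p c c c) (off a) (p c a a) (p c c a)
        where
        regroup : ∀ C O P Q → C + (O + O + (P + P + Q)) ≡ Q + (P + P + (C + O + O))
        regroup = NatSolver.solve-∀
      ... | inj₂ (inj₂ leaf-i) = leaf-diagonal leaf-i

      star-pattern : AmorphicPattern
      star-pattern = record
        { N = star-N ; g⁺ = star-g⁺ ; g⁻ = star-g⁻
        ; u⁺ = p c c c + off a + off a ; u⁻ = p c a a + p c a a + p c c a
        ; pattern-off = star-off ; pattern-left = star-left ; pattern-right = star-right ; pattern-diag = star-diag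
        }

-- Four classes

select : ∀ {P : Set} → Dec P → ℕ → ℕ
select (yes _) a = a
select (no _)  _ = 0

select≡𝟙* : ∀ {P : Set} (P? : Dec P) a → select P? a ≡ 𝟙 P? * a
select≡𝟙* (yes _) a = sym (*-identityˡ a)
select≡𝟙* (no _)  a = refl

module _ {n} {A : Fin 5 → Mat n} (S : IsSymAssocScheme n 4 A) where
  open Scheme S

  -- The selector inside Defs.fuse is local to that definition, so its summands only compute once
  -- the five decisions f l F.≟ k have been split; select is a copy of it.
  fuse≡∑select : ∀ {e} (f : Fin 5 → Fin (suc e)) k x y → fuse f A k x y ≡ ∑[ l < 5 ] select (f l F.≟ k) (A l x y)
  fuse≡∑select f k x y
    with f 0F F.≟ k | f 1F F.≟ k | f 2F F.≟ k | f 3F F.≟ k | f 4F F.≟ k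
  ... | yes _ | yes _ | yes _ | yes _ | yes _ = refl
  ... | yes _ | yes _ | yes _ | yes _ | no _  = refl
  ... | yes _ | yes _ | yes _ | no _  | yes _ = refl
  ... | yes _ | yes _ | yes _ | no _  | no _  = refl
  ... | yes _ | yes _ | no _  | yes _ | yes _ = refl
  ... | yes _ | yes _ | no _  | yes _ | no _  = refl
  ... | yes _ | yes _ | no _  | no _  | yes _ = refl
  ... | yes _ | yes _ | no _  | no _  | no _  = refl
  ... | yes _ | no _  | yes _ | yes _ | yes _ = refl
  ... | yes _ | no _  | yes _ | yes _ | no _  = refl
  ... | yes _ | no _  | yes _ | no _  | yes _ = refl
  ... | yes _ | no _  | yes _ | no _  | no _  = refl
  ... | yes _ | no _  | no _  | yes _ | yes _ = refl
  ... | yes _ | no _  | no _  | yes _ | no _  = refl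
  ... | yes _ | no _  | no _  | no _  | yes _ = refl
  ... | yes _ | no _  | no _  | no _  | no _  = refl
  ... | no _  | yes _ | yes _ | yes _ | yes _ = refl
  ... | no _  | yes _ | yes _ | yes _ | no _  = refl
  ... | no _  | yes _ | yes _ | no _  | yes _ = refl
  ... | no _  | yes _ | yes _ | no _  | no _  = refl
  ... | no _  | yes _ | no _  | yes _ | yes _ = refl
  ... | no _  | yes _ | no _  | yes _ | no _  = refl
  ... | no _  | yes _ | no _  | no _  | yes _ = refl
  ... | no _  | yes _ | no _  | no _  | no _  = refl
  ... | no _  | no _  | yes _ | yes _ | yes _ = refl
  ... | no _  | no _  | yes _ | yes _ | no _  = refl
  ... | no _  | no _  | yes _ | no _  | yes _ = refl
  ... | no _  | no _  | yes _ | no _  | no _  = refl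
  ... | no _  | no _  | no _  | yes _ | yes _ = refl
  ... | no _  | no _  | no _  | yes _ | no _  = refl
  ... | no _  | no _  | no _  | no _  | yes _ = refl
  ... | no _  | no _  | no _  | no _  | no _  = refl

  fuse≡fused : ∀ {e} (f : Fin 5 → Fin (suc e)) k x y → fuse f A k x y ≡ fused f k x y
  fuse≡fused f k x y = trans (fuse≡∑select f k x y) (sum-cong-≗ λ l → select≡𝟙* (f l F.≟ k) (A l x y))

  pairFuses⇒mergeIdentities : ∀ {c x} → PairFuses n 3 A c x → MergeIdentities c x
  pairFuses⇒mergeIdentities (_ , _ , c≢x , f , merges , _ , scheme) =
    Merge.identities c≢x merges (closed⇒fibreInvariant f (IsSymAssocScheme.closed (IsSymAssocScheme-resp (fuse≡fused f) scheme)))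

-- Decided by evaluation over all of Fin 5; this is where the number of classes enters.
five-labels : ∀ (c a b e : Fin 5) →
  c ≢ 0F × a ≢ 0F × b ≢ 0F × e ≢ 0F × c ≢ a × c ≢ b × c ≢ e × a ≢ b × a ≢ e × b ≢ e →
  ∀ i → i ≡ 0F ⊎ i ≡ c ⊎ i ≡ a ⊎ i ≡ b ⊎ i ≡ e
five-labels = toWitness {a? = all? λ c → all? λ a → all? λ b → all? λ e →
  (¬? (c F.≟ 0F) ×-dec ¬? (a F.≟ 0F) ×-dec ¬? (b F.≟ 0F) ×-dec ¬? (e F.≟ 0F) ×-dec ¬? (c F.≟ a) ×-dec
   ¬? (c F.≟ b) ×-dec ¬? (c F.≟ e) ×-dec ¬? (a F.≟ b) ×-dec ¬? (a F.≟ e) ×-dec ¬? (b F.≟ e))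
  →-dec all? λ i → i F.≟ 0F ⊎-dec i F.≟ c ⊎-dec i F.≟ a ⊎-dec i F.≟ b ⊎-dec i F.≟ e} _

lemma6p2 : (n : ℕ) (A : Fin 5 → Mat n) → IsSymAssocScheme n 4 A
         → ContainsK13 n 3 A → Amorphic n 4 A
lemma6p2 n A S (c , a , b , e , a≢b , a≢e , b≢e , c~a , c~b , c~e) _ f partition =
  IsSymAssocScheme-resp (λ k x y → sym (fuse≡fused S f k x y))
    (fused-scheme f partition (pattern⇒fibreInvariant (star-pattern cover) f (proj₂ partition)))
  where
  open Scheme S
  open Star a≢b a≢e b≢e (pairFuses⇒mergeIdentities S c~a) (pairFuses⇒mergeIdentities S c~b) (pairFuses⇒mergeIdentities S c~e)
  cover : ∀ i → i ≡ zero ⊎ i ≡ c ⊎ Leaf i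
  cover = let c≢0 , a≢0 , c≢a , _ = c~a ; _ , b≢0 , c≢b , _ = c~b ; _ , e≢0 , c≢e , _ = c~e in
    five-labels c a b e (c≢0 , a≢0 , b≢0 , e≢0 , c≢a , c≢b , c≢e , a≢b , a≢e , b≢e)
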